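{- Let $\Gamma$ be a finite simple graph such that $S\Omega(\Gamma)$ is isomorphic to one of the graphs $4K_1$ (four isolated vertices), $K_1+P_3$ (disjoint union of an isolated vertex and a path on three vertices), $P_4$, $C_4$, or $K_{1,3}$. Then $\mathrm{rank}(I+A(\Gamma))=4$.
   Context: $A(\Gamma)$ is the adjacency matrix of $\Gamma$; rank is over the reals. For a graph $\Gamma$, consider partitions of $V(\Gamma)$ into nonempty parts such that each part induces a complete subgraph and, for any two distinct parts $P,Q$, either every vertex of $P$ is adjacent to every vertex of $Q$ or no vertex of $P$ is adjacent to any vertex of $Q$. The complete skeleton $\Omega(\Gamma)$ is such a partition with the minimum number of parts; its structure $S\Omega(\Gamma)$ is the simple graph whose vertices are the parts, two parts being adjacent iff they are completely joined. -}

module Defs where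

open import Data.Nat using (ℕ; zero; suc; _≤_)
open import Data.Fin using (Fin; zero; suc)
open import Data.Fin.Properties using (_≟_)
open import Data.Bool using (Bool; true; false; if_then_else_; _∨_; _∧_)
open import Data.List using (List; []; _∷_)
open import Data.Bool.ListAction using (any)
open import Data.Product using (Σ; ∃; _×_; _,_)
open import Relation.Nullary using (¬_; does)
open import Relation.Binary.PropositionalEquality using (_≡_; _≢_)
open import Function.Bundles using (_⤖_; _⇔_; Bijection)
open import Data.Rational using (ℚ; 0ℚ; 1ℚ; _+_; _*_)

record Graph (n : ℕ) : Set where
  field
    adj   : Fin n → Fin n → Bool
    sym   : ∀ u v → adj u v ≡ adj v u
    irrefl : ∀ u → adj u u ≡ false
open Graph public

-- Partitions of V(Γ) into m nonempty labelled parts: a surjection Fin n → Fin m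

Surjective : ∀ {n m} → (Fin n → Fin m) → Set
Surjective {n} {m} p = ∀ (a : Fin m) → ∃ λ (u : Fin n) → p u ≡ a

PartsAreCliques : ∀ {n m} → Graph n → (Fin n → Fin m) → Set
PartsAreCliques Γ p = ∀ u v → p u ≡ p v → u ≢ v → adj Γ u v ≡ true

PartsHomogeneous : ∀ {n m} → Graph n → (Fin n → Fin m) → Set
PartsHomogeneous Γ p =
  ∀ u u' v v' → p u ≡ p u' → p v ≡ p v' → p u ≢ p v → adj Γ u v ≡ adj Γ u' v'

IsCliqueModulePartition : ∀ {n m} → Graph n → (Fin n → Fin m) → Set
IsCliqueModulePartition Γ p = Surjective p × PartsAreCliques Γ p × PartsHomogeneous Γ p

IsCompleteSkeleton : ∀ {n m} → Graph n → (Fin n → Fin m) → Set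
IsCompleteSkeleton {n} {m} Γ p =
  IsCliqueModulePartition Γ p ×
  (∀ (m' : ℕ) (q : Fin n → Fin m') → IsCliqueModulePartition Γ q → m ≤ m')

-- Structure graph SΩ(Γ): parts a ≠ b adjacent iff completely joined
-- (equivalently, given homogeneity, some vertex of a is adjacent to some vertex of b).
StructAdj : ∀ {n m} → Graph n → (Fin n → Fin m) → Fin m → Fin m → Set
StructAdj {n} Γ p a b =
  a ≢ b × (∀ (u v : Fin n) → p u ≡ a → p v ≡ b → adj Γ u v ≡ true)

eqF : ∀ {k} → Fin k → Fin k → Bool
eqF a b = does (a ≟ b)

fromEdges : List (Fin 4 × Fin 4) → Fin 4 → Fin 4 → Bool
fromEdges es a b = any (λ { (x , y) → (eqF x a ∧ eqF y b) ∨ (eqF x b ∧ eqF y a) }) es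

v0 v1 v2 v3 : Fin 4
v0 = zero
v1 = suc zero
v2 = suc (suc zero)
v3 = suc (suc (suc zero))

4K₁ K₁+P₃ P₄ C₄ K₁,₃ : Fin 4 → Fin 4 → Bool
4K₁   = fromEdges []
K₁+P₃ = fromEdges ((v1 , v2) ∷ (v2 , v3) ∷ [])
P₄    = fromEdges ((v0 , v1) ∷ (v1 , v2) ∷ (v2 , v3) ∷ [])
C₄    = fromEdges ((v0 , v1) ∷ (v1 , v2) ∷ (v2 , v3) ∷ (v3 , v0) ∷ [])
K₁,₃  = fromEdges ((v0 , v1) ∷ (v0 , v2) ∷ (v0 , v3) ∷ [])

StructIsoTo : ∀ {n m} → Graph n → (Fin n → Fin m) → (Fin 4 → Fin 4 → Bool) → Set
StructIsoTo {n} {m} Γ p H =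
  Σ (Fin 4 ⤖ Fin m) λ σ →
    ∀ a b → (H a b ≡ true) ⇔ StructAdj Γ p (Bijection.to σ a) (Bijection.to σ b)

sumFin : ∀ {k} → (Fin k → ℚ) → ℚ
sumFin {zero}  f = 0ℚ
sumFin {suc k} f = f zero + sumFin (λ i → f (suc i))

Matrix : ℕ → Set
Matrix n = Fin n → Fin n → ℚ

RowsIndependent : ∀ {n k} → Matrix n → (Fin k → Fin n) → Set
RowsIndependent {n} {k} M r =
  ∀ (c : Fin k → ℚ) → (∀ (j : Fin n) → sumFin (λ i → c i * M (r i) j) ≡ 0ℚ) →
  ∀ i → c i ≡ 0ℚ

HasRank : ∀ {n} → Matrix n → ℕ → Set
HasRank {n} M k =
  (∃ λ (r : Fin k → Fin n) → RowsIndependent M r) ×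
  (∀ (r : Fin (suc k) → Fin n) → ¬ RowsIndependent M r)

b2q : Bool → ℚ
b2q true  = 1ℚ
b2q false = 0ℚ

IplusA : ∀ {n} → Graph n → Matrix n
IplusA Γ i j = b2q (eqF i j) + b2q (adj Γ i j)

{-# OPTIONS --safe #-}
-- Vertices in one part of a clique-module partition have identical rows in I + A(Γ): a part is a
-- clique, so its vertices are adjacent to each other and to themselves via I, and homogeneity
-- makes them agree outside the part. Hence rank(I + A(Γ)) is at most the number of parts, and
-- choosing one vertex per part exhibits I + A(SΩ(Γ)) as a principal submatrix, so the rank is
-- exactly the number of parts as soon as I + A(SΩ(Γ)) is nonsingular. For each of the five
-- structure graphs in question I + A is a nonsingular 4 × 4 matrix; we exhibit its inverse.
module Submission where

open import Defs
open import Data.Nat using (ℕ)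
open import Data.Fin using (Fin)
open import Data.Sum using (_⊎_)

open import Algebra.Bundles using (CommutativeRing)
open import Data.Bool using (Bool; true; false)
open import Data.Empty using (⊥-elim)
open import Data.Fin using (zero; suc)
open import Data.Fin.Properties using (_≟_; all?; pigeonhole; <⇒≢)
import Data.Integer as ℤ
open import Data.Nat using (zero; suc)
open import Data.Nat.Properties using (n<1+n)
open import Data.Product using (_,_; proj₁; proj₂)
open import Data.Rational using (ℚ; 0ℚ; 1ℚ; ½; -½; _+_; _-_; _*_; _/_; -_)
import Data.Rational.Properties as ℚ
open import Data.Rational.Solver using (module +-*-Solver)
open import Data.Sum using ([_,_])
open import Data.Vec using (Vec; []; _∷_; lookup)
open import Function.Bundles using (_⤖_; _⇔_; Bijection; Equivalence; Surjection; mk⇔)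
open import Relation.Binary.PropositionalEquality
  using (_≡_; _≢_; refl; trans; cong; cong₂; module ≡-Reasoning)
  renaming (sym to ≡-sym)
open import Relation.Nullary using (¬_; Dec; yes; no)
open import Relation.Nullary.Decidable using (True; toWitness; dec-true; dec-false)

open import Algebra.Properties.Semiring.Sum (CommutativeRing.semiring ℚ.+-*-commutativeRing)
  using (sum; sum-cong-≗; sum-replicate-zero; ∑-comm; ∑-distrib-+; *-distribˡ-sum; *-distribʳ-sum)


sumFin≡sum : ∀ {k} (f : Fin k → ℚ) → sumFin f ≡ sum f
sumFin≡sum {zero}  f = refl
sumFin≡sum {suc k} f = cong (f zero +_) (sumFin≡sum (λ i → f (suc i)))

sumFin-cong : ∀ {k} {f g : Fin k → ℚ} → (∀ x → f x ≡ g x) → sumFin f ≡ sumFin g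
sumFin-cong {f = f} {g} f≗g = trans (sumFin≡sum f) (trans (sum-cong-≗ f≗g) (≡-sym (sumFin≡sum g)))

sum-*-δ : ∀ {k} (f : Fin k → ℚ) (i : Fin k) → sum (λ x → f x * b2q (eqF x i)) ≡ f i
sum-*-δ {suc k} f zero = begin
  f zero * 1ℚ + sum (λ x → f (suc x) * 0ℚ)  ≡⟨ cong₂ _+_ (ℚ.*-identityʳ (f zero)) sum-*0 ⟩
  f zero + 0ℚ                               ≡⟨ ℚ.+-identityʳ (f zero) ⟩
  f zero                                    ∎
  where
  open ≡-Reasoning
  sum-*0 : sum (λ x → f (suc x) * 0ℚ) ≡ 0ℚ
  sum-*0 = trans (sum-cong-≗ (λ x → ℚ.*-zeroʳ (f (suc x)))) (sum-replicate-zero k)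
sum-*-δ {suc k} f (suc i) = begin
  f zero * 0ℚ + sum (λ x → f (suc x) * b2q (eqF x i))  ≡⟨ cong₂ _+_ (ℚ.*-zeroʳ (f zero)) (sum-*-δ (λ x → f (suc x)) i) ⟩
  0ℚ + f (suc i)                                       ≡⟨ ℚ.+-identityˡ (f (suc i)) ⟩
  f (suc i)                                            ∎
  where open ≡-Reasoning


IsRightInverse : ∀ {k} → Matrix k → Matrix k → Set
IsRightInverse M B = ∀ i j → sum (λ l → M i l * B l j) ≡ b2q (eqF i j)

rowsIndependent-of-rightInverse : ∀ {k} (M B : Matrix k) →
                                  IsRightInverse M B → RowsIndependent M (λ i → i)
rowsIndependent-of-rightInverse {k} M B MB≡I c cM≡0 j = begin
  c j                                            ≡⟨ ≡-sym (sum-*-δ c j) ⟩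
  sum (λ i → c i * b2q (eqF i j))                ≡⟨ sum-cong-≗ (λ i → cong (c i *_) (≡-sym (MB≡I i j))) ⟩
  sum (λ i → c i * sum (λ l → M i l * B l j))    ≡⟨ sum-cong-≗ (λ i → *-distribˡ-sum (c i) (λ l → M i l * B l j)) ⟩
  sum (λ i → sum (λ l → c i * (M i l * B l j)))  ≡⟨ ∑-comm (λ i l → c i * (M i l * B l j)) ⟩
  sum (λ l → sum (λ i → c i * (M i l * B l j)))  ≡⟨ sum-cong-≗ (λ l → sum-cong-≗ (λ i → ≡-sym (ℚ.*-assoc (c i) (M i l) (B l j)))) ⟩
  sum (λ l → sum (λ i → c i * M i l * B l j))    ≡⟨ sum-cong-≗ (λ l → ≡-sym (*-distribʳ-sum (B l j) (λ i → c i * M i l))) ⟩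
  sum (λ l → sum (λ i → c i * M i l) * B l j)    ≡⟨ sum-cong-≗ (λ l → cong (_* B l j) (trans (≡-sym (sumFin≡sum (λ i → c i * M i l))) (cM≡0 l))) ⟩
  sum (λ l → 0ℚ * B l j)                         ≡⟨ sum-cong-≗ (λ l → ℚ.*-zeroˡ (B l j)) ⟩
  sum {k} (λ _ → 0ℚ)                             ≡⟨ sum-replicate-zero k ⟩
  0ℚ                                             ∎
  where open ≡-Reasoning

rowsDependent-of-equalRows : ∀ {n k} (M : Matrix n) (r : Fin k → Fin n) {i j : Fin k} → i ≢ j →
                             (∀ l → M (r i) l ≡ M (r j) l) → ¬ RowsIndependent M r
rowsDependent-of-equalRows {k = k} M r {i} {j} i≢j rowᵢ≡rowⱼ indep =
  ℚ.1≢0 (trans (≡-sym cᵢ≡1) (indep c c·M≡0 i))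
  where
  c : Fin k → ℚ
  c x = b2q (eqF x i) - b2q (eqF x j)

  cᵢ≡1 : c i ≡ 1ℚ
  cᵢ≡1 rewrite dec-true (i ≟ i) refl | dec-false (i ≟ j) i≢j = refl

  split : ∀ a b v → v * (a - b) ≡ v * a + (- 1ℚ) * (v * b)
  split = solve 3 (λ a b v → v :* (a :- b) := v :* a :+ con (- 1ℚ) :* (v :* b)) refl
    where open +-*-Solver

  cancel : ∀ v → v + (- 1ℚ) * v ≡ 0ℚ
  cancel = solve 1 (λ v → v :+ con (- 1ℚ) :* v := con 0ℚ) refl
    where open +-*-Solver

  c·M≡0 : ∀ l → sumFin (λ x → c x * M (r x) l) ≡ 0ℚ
  c·M≡0 l = begin
    sumFin (λ x → c x * v x)                                   ≡⟨ sumFin≡sum (λ x → c x * v x) ⟩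
    sum (λ x → c x * v x)                                      ≡⟨ sum-cong-≗ (λ x → trans (ℚ.*-comm (c x) (v x)) (split (b2q (eqF x i)) (b2q (eqF x j)) (v x))) ⟩
    sum (λ x → v x * b2q (eqF x i) + (- 1ℚ) * (v x * b2q (eqF x j)))
                                                               ≡⟨ ∑-distrib-+ (λ x → v x * b2q (eqF x i)) (λ x → (- 1ℚ) * (v x * b2q (eqF x j))) ⟩
    sum (λ x → v x * b2q (eqF x i)) + sum (λ x → (- 1ℚ) * (v x * b2q (eqF x j)))
                                                               ≡⟨ cong₂ _+_ (sum-*-δ v i) (≡-sym (*-distribˡ-sum (- 1ℚ) (λ x → v x * b2q (eqF x j)))) ⟩
    v i + (- 1ℚ) * sum (λ x → v x * b2q (eqF x j))             ≡⟨ cong (λ t → v i + (- 1ℚ) * t) (trans (sum-*-δ v j) (≡-sym (rowᵢ≡rowⱼ l))) ⟩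
    v i + (- 1ℚ) * v i                                         ≡⟨ cancel (v i) ⟩
    0ℚ                                                         ∎
    where
    open ≡-Reasoning
    v : Fin k → ℚ
    v x = M (r x) l

rowsIndependent-of-submatrix : ∀ {n k} (M : Matrix n) (N : Matrix k) (r : Fin k → Fin n) →
                               (∀ a b → M (r a) (r b) ≡ N a b) →
                               RowsIndependent N (λ a → a) → RowsIndependent M r
rowsIndependent-of-submatrix M N r M∘r≡N indepN c c·M≡0 =
  indepN c (λ b → trans (sumFin-cong (λ a → cong (c a *_) (≡-sym (M∘r≡N a b)))) (c·M≡0 (r b)))

rowsDependent-of-rowClasses : ∀ {n k} (M : Matrix n) (q : Fin n → Fin k) →
                              (∀ u u' → q u ≡ q u' → ∀ l → M u l ≡ M u' l) →
                              (r : Fin (suc k) → Fin n) → ¬ RowsIndependent M r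
rowsDependent-of-rowClasses {k = k} M q sameRow r
  with i , j , i<j , qrᵢ≡qrⱼ ← pigeonhole (n<1+n k) (λ x → q (r x)) =
  rowsDependent-of-equalRows M r (<⇒≢ i<j) (sameRow (r i) (r j) qrᵢ≡qrⱼ)


IplusAdj : ∀ {k} → (Fin k → Fin k → Bool) → Matrix k
IplusAdj H i j = b2q (eqF i j) + b2q (H i j)

≡true⇔≡true⇒≡ : ∀ {a b : Bool} → (a ≡ true ⇔ b ≡ true) → a ≡ b
≡true⇔≡true⇒≡ {false} {false} _   = refl
≡true⇔≡true⇒≡ {false} {true}  a⇔b = Equivalence.from a⇔b refl
≡true⇔≡true⇒≡ {true}  {false} a⇔b = ≡-sym (Equivalence.to a⇔b refl)
≡true⇔≡true⇒≡ {true}  {true}  _   = refl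

module _ {n m} {Γ : Graph n} {p : Fin n → Fin m} (partition : IsCliqueModulePartition Γ p) where

  private
    surjective  = proj₁ partition
    cliques     = proj₁ (proj₂ partition)
    homogeneous = proj₂ (proj₂ partition)

  IplusA-within-part : ∀ u v → p u ≡ p v → IplusA Γ u v ≡ 1ℚ
  IplusA-within-part u v pu≡pv with u ≟ v
  ... | yes refl rewrite irrefl Γ u = refl
  ... | no u≢v rewrite cliques u v pu≡pv u≢v = refl

  IplusA-rows-within-part : ∀ u u' → p u ≡ p u' → ∀ v → IplusA Γ u v ≡ IplusA Γ u' v
  IplusA-rows-within-part u u' pu≡pu' v with p u ≟ p v
  ... | yes pu≡pv =
    trans (IplusA-within-part u v pu≡pv) (≡-sym (IplusA-within-part u' v (trans (≡-sym pu≡pu') pu≡pv)))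
  ... | no pu≢pv
    rewrite dec-false (u ≟ v) (λ u≡v → pu≢pv (cong p u≡v))
          | dec-false (u' ≟ v) (λ u'≡v → pu≢pv (trans pu≡pu' (cong p u'≡v)))
          | homogeneous u u' v v pu≡pu' refl pu≢pv = refl

  module _ {k} (H : Fin k → Fin k → Bool) (σ : Fin k ⤖ Fin m)
           (iso : ∀ a b → (H a b ≡ true) ⇔ StructAdj Γ p (Bijection.to σ a) (Bijection.to σ b)) where

    open Bijection σ using (to; injective)
    open Surjection (Bijection.surjection σ) using (to⁻; to∘to⁻)

    rep : Fin k → Fin n
    rep a = proj₁ (surjective (to a))

    p-rep : ∀ a → p (rep a) ≡ to a
    p-rep a = proj₂ (surjective (to a))

    H-irrefl : ∀ a → H a a ≡ false
    H-irrefl a with H a a in Haa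
    ... | false = refl
    ... | true  = ⊥-elim (proj₁ (Equivalence.to (iso a a) Haa) refl)

    adj-rep : ∀ {a b} → a ≢ b → adj Γ (rep a) (rep b) ≡ H a b
    adj-rep {a} {b} a≢b = ≡true⇔≡true⇒≡ (mk⇔ joined⇒H H⇒adjacent)
      where
      toa≢tob : to a ≢ to b
      toa≢tob e = a≢b (injective e)

      joined⇒H : adj Γ (rep a) (rep b) ≡ true → H a b ≡ true
      joined⇒H adjacent = Equivalence.from (iso a b) (toa≢tob , λ u v pu≡ pv≡ →
        trans (homogeneous u (rep a) v (rep b) (trans pu≡ (≡-sym (p-rep a))) (trans pv≡ (≡-sym (p-rep b)))
                           (λ pu≡pv → toa≢tob (trans (≡-sym pu≡) (trans pu≡pv pv≡))))
              adjacent)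

      H⇒adjacent : H a b ≡ true → adj Γ (rep a) (rep b) ≡ true
      H⇒adjacent Hab = proj₂ (Equivalence.to (iso a b) Hab) (rep a) (rep b) (p-rep a) (p-rep b)

    IplusA-rep : ∀ a b → IplusA Γ (rep a) (rep b) ≡ IplusAdj H a b
    IplusA-rep a b with a ≟ b
    ... | yes refl rewrite H-irrefl a = IplusA-within-part (rep a) (rep a) refl
    ... | no a≢b
      rewrite dec-false (rep a ≟ rep b) (λ e → a≢b (injective (trans (≡-sym (p-rep a)) (trans (cong p e) (p-rep b)))))
            | adj-rep a≢b = refl

    part : Fin n → Fin k
    part u = to⁻ (p u)

    IplusA-rows-of-part : ∀ u u' → part u ≡ part u' → ∀ v → IplusA Γ u v ≡ IplusA Γ u' v
    IplusA-rows-of-part u u' e =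
      IplusA-rows-within-part u u' (trans (≡-sym (to∘to⁻ (p u))) (trans (cong to e) (to∘to⁻ (p u'))))

    hasRank-of-structure : RowsIndependent (IplusAdj H) (λ a → a) → HasRank (IplusA Γ) k
    hasRank-of-structure indepH =
      (rep , rowsIndependent-of-submatrix (IplusA Γ) (IplusAdj H) rep IplusA-rep indepH) ,
      rowsDependent-of-rowClasses (IplusA Γ) part IplusA-rows-of-part


fromRows : ∀ {k} → Vec (Vec ℚ k) k → Matrix k
fromRows rows i j = lookup (lookup rows i) j

isRightInverse? : ∀ {k} (M B : Matrix k) → Dec (IsRightInverse M B)
isRightInverse? M B = all? λ i → all? λ j → sum (λ l → M i l * B l j) ℚ.≟ b2q (eqF i j)

-1ℚ ⅓ -⅔ : ℚ
-1ℚ = - 1ℚ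
⅓   = ℤ.+ 1 / 3
-⅔  = - (ℤ.+ 2 / 3)

4K₁⁻¹ K₁+P₃⁻¹ P₄⁻¹ C₄⁻¹ K₁,₃⁻¹ : Matrix 4
4K₁⁻¹ = fromRows
  ( (1ℚ ∷ 0ℚ ∷ 0ℚ ∷ 0ℚ ∷ [])
  ∷ (0ℚ ∷ 1ℚ ∷ 0ℚ ∷ 0ℚ ∷ [])
  ∷ (0ℚ ∷ 0ℚ ∷ 1ℚ ∷ 0ℚ ∷ [])
  ∷ (0ℚ ∷ 0ℚ ∷ 0ℚ ∷ 1ℚ ∷ [])
  ∷ [])
K₁+P₃⁻¹ = fromRows
  ( (1ℚ ∷ 0ℚ  ∷ 0ℚ  ∷ 0ℚ  ∷ [])
  ∷ (0ℚ ∷ 0ℚ  ∷ 1ℚ  ∷ -1ℚ ∷ [])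
  ∷ (0ℚ ∷ 1ℚ  ∷ -1ℚ ∷ 1ℚ  ∷ [])
  ∷ (0ℚ ∷ -1ℚ ∷ 1ℚ  ∷ 0ℚ  ∷ [])
  ∷ [])
P₄⁻¹ = fromRows
  ( (1ℚ  ∷ 0ℚ  ∷ -1ℚ ∷ 1ℚ  ∷ [])
  ∷ (0ℚ  ∷ 0ℚ  ∷ 1ℚ  ∷ -1ℚ ∷ [])
  ∷ (-1ℚ ∷ 1ℚ  ∷ 0ℚ  ∷ 0ℚ  ∷ [])
  ∷ (1ℚ  ∷ -1ℚ ∷ 0ℚ  ∷ 1ℚ  ∷ [])
  ∷ [])
C₄⁻¹ = fromRows
  ( (⅓  ∷ ⅓  ∷ -⅔ ∷ ⅓  ∷ [])
  ∷ (⅓  ∷ ⅓  ∷ ⅓  ∷ -⅔ ∷ [])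
  ∷ (-⅔ ∷ ⅓  ∷ ⅓  ∷ ⅓  ∷ [])
  ∷ (⅓  ∷ -⅔ ∷ ⅓  ∷ ⅓  ∷ [])
  ∷ [])
K₁,₃⁻¹ = fromRows
  ( (-½ ∷ ½  ∷ ½  ∷ ½  ∷ [])
  ∷ (½  ∷ ½  ∷ -½ ∷ -½ ∷ [])
  ∷ (½  ∷ -½ ∷ ½  ∷ -½ ∷ [])
  ∷ (½  ∷ -½ ∷ -½ ∷ ½  ∷ [])
  ∷ [])

theorem5p4 : ∀ (n : ℕ) (Γ : Graph n) (m : ℕ) (p : Fin n → Fin m) →
    IsCompleteSkeleton Γ p →
    (StructIsoTo Γ p 4K₁ ⊎ StructIsoTo Γ p K₁+P₃ ⊎ StructIsoTo Γ p P₄ ⊎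
     StructIsoTo Γ p C₄ ⊎ StructIsoTo Γ p K₁,₃) →
    HasRank (IplusA Γ) 4
theorem5p4 n Γ m p (partition , _) =
  [ rank 4K₁ 4K₁⁻¹ , [ rank K₁+P₃ K₁+P₃⁻¹ , [ rank P₄ P₄⁻¹ , [ rank C₄ C₄⁻¹ , rank K₁,₃ K₁,₃⁻¹ ] ] ] ]
  where
  rank : ∀ (H : Fin 4 → Fin 4 → Bool) (B : Matrix 4) →
         {True (isRightInverse? (IplusAdj H) B)} → StructIsoTo Γ p H → HasRank (IplusA Γ) 4
  rank H B {H·B≡I} (σ , iso) = hasRank-of-structure {Γ = Γ} {p = p} partition H σ iso
    (rowsIndependent-of-rightInverse (IplusAdj H) B (toWitness {a? = isRightInverse? (IplusAdj H) B} H·B≡I))
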